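{- Let $(i,c)$ be an $I$-pointed partially observable $FT(\_)^A$-coalgebra with $i\colon I\to S$ and $c=\langle\delta,\mathrm{obs}\rangle\colon S\to(FTS)^A\times O$. Let $m\colon S'\to S^+$ be a monomorphism, $\delta'\colon S'\to(FTS')^A$ and $i'\colon I\to S'$ be such that $m\circ i'=\mathsf{nil}_S\circ i$ and $\pi_1\mathsf{Hist}(c)\circ m=(FTm)^A\circ\delta'$ (i.e. $(i',\delta')$ is an $I$-pointed $FT(\_)^A$-subcoalgebra of $(\mathsf{nil}_S\circ i,\pi_1\mathsf{Hist}(c))$ via $m$). If $\mathrm{obs}^+\circ m\colon S'\to O^+$ is a split monomorphism, then $H(i,\langle\delta,\mathrm{obs}\rangle)=H(i,\langle\delta,\mathrm{id}_S\rangle)$.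
   Context: $\mathcal{C}$ is a cartesian closed category with finite products, pullbacks and countable coproducts; $f^\dagger$ is adjoint transpose. $T=(T,\eta,\mu)$ is a strong monad and $F$ a strong endofunctor; $\mathrm{st}$ denotes the strengths of $T$, $F$, $FT$ (used on either side via symmetry). $A$, $I$ are fixed objects. $\Omega$ is an ordered object (each $\mathcal{C}(X,\Omega)$ a complete lattice, precomposition preserving arbitrary joins, bottom $\bot$); $\tau\colon FT\Omega\to\Omega$ is a monotone algebra. For an $FT$-coalgebra $e\colon X\to FTX$, $\Phi_e(g):=\tau\circ FTg\circ e$. Sequences: $X^*=\coprod_{n\ge0}X^n$, $X^+=\coprod_{n\ge1}X^n$ (functorial; $\mathrm{obs}^+$ applies $\mathrm{obs}$ componentwise); $\mathsf{nil}_X\colon X\to X^+$ the inclusion of length-one sequences; $\mathsf{ext}_S\colon S^+\times S\to S^+$ appends an element; $\mathrm{last}\colon S^+\to S$ takes the last element. For a partially observable coalgebra $e=\langle\gamma,p\rangle\colon X\to(FTX)^A\times P$ and $u\colon P\to A$, $e_u:=\mathrm{ev}\circ\langle\gamma,u\circ p\rangle\colon X\to FTX$. For $c=\langle\delta,p\rangle\colon S\to(FTS)^A\times P$ (with $P=O$, $p=\mathrm{obs}$, or $P=S$, $p=\mathrm{id}_S$), $\mathsf{Hist}(c):=\langle h,p^+\rangle\colon S^+\to(FT(S^+))^A\times P^+$ where $h$ is $S^+\xrightarrow{\langle\mathrm{id},\delta\circ\mathrm{last}\rangle}S^+\times(FTS)^A\xrightarrow{(\mathrm{st}\circ(\mathrm{id}_{S^+}\times\mathrm{ev}))^\dagger}(FT(S^+\times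 S))^A\xrightarrow{(FT\mathsf{ext}_S)^A}(FT(S^+))^A$, and $\pi_1\mathsf{Hist}(c)=h$. Define $H(i,c):=\bigvee_{u\colon P^+\to A,\,n\in\mathbb{N}}\Phi^n_{\mathsf{Hist}(c)_u}(\bot)\circ\mathsf{nil}_S\circ i\colon I\to\Omega$. -}

module Defs where

open import Level using (Level; _⊔_; Lift) renaming (suc to lsuc)
open import Data.Nat using (ℕ; zero; suc)
open import Data.Empty using (⊥)
open import Data.Product using (Σ; _,_) renaming (_×_ to _×ₚ_)
open import Relation.Binary using (Rel; IsEquivalence; IsPartialOrder)

record Category (o ℓ e : Level) : Set (lsuc (o ⊔ ℓ ⊔ e)) where
  infix  4 _≈_
  infix  3 _⇒_
  infixr 9 _∘_
  field
    Obj       : Set o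
    _⇒_       : Obj → Obj → Set ℓ
    _≈_       : ∀ {X Y} → Rel (X ⇒ Y) e
    id        : ∀ {X} → X ⇒ X
    _∘_       : ∀ {X Y Z} → Y ⇒ Z → X ⇒ Y → X ⇒ Z
    equiv     : ∀ {X Y} → IsEquivalence (_≈_ {X} {Y})
    ∘-resp-≈  : ∀ {X Y Z} {f f′ : Y ⇒ Z} {g g′ : X ⇒ Y} →
                f ≈ f′ → g ≈ g′ → f ∘ g ≈ f′ ∘ g′
    assoc     : ∀ {W X Y Z} {f : W ⇒ X} {g : X ⇒ Y} {h : Y ⇒ Z} →
                (h ∘ g) ∘ f ≈ h ∘ (g ∘ f)
    identityˡ : ∀ {X Y} {f : X ⇒ Y} → id ∘ f ≈ f
    identityʳ : ∀ {X Y} {f : X ⇒ Y} → f ∘ id ≈ f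

module _ {o ℓ e} (C : Category o ℓ e) where
  open Category C

  Mono : ∀ {X Y} → X ⇒ Y → Set (o ⊔ ℓ ⊔ e)
  Mono {X} m = ∀ {Z} (g h : Z ⇒ X) → m ∘ g ≈ m ∘ h → g ≈ h

  SplitMono : ∀ {X Y} → X ⇒ Y → Set (ℓ ⊔ e)
  SplitMono {X} {Y} m = Σ (Y ⇒ X) (λ r → r ∘ m ≈ id)

record CCCStructure {o ℓ e} (C : Category o ℓ e) : Set (o ⊔ ℓ ⊔ e) where
  open Category C
  infixr 7 _×_
  infixl 8 _^_
  field
    ⊤        : Obj
    !        : ∀ {X} → X ⇒ ⊤
    !-unique : ∀ {X} (f : X ⇒ ⊤) → f ≈ !
    _×_      : Obj → Obj → Obj
    π₁       : ∀ {X Y} → X × Y ⇒ X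
    π₂       : ∀ {X Y} → X × Y ⇒ Y
    ⟨_,_⟩    : ∀ {Z X Y} → Z ⇒ X → Z ⇒ Y → Z ⇒ X × Y
    project₁ : ∀ {Z X Y} {f : Z ⇒ X} {g : Z ⇒ Y} → π₁ ∘ ⟨ f , g ⟩ ≈ f
    project₂ : ∀ {Z X Y} {f : Z ⇒ X} {g : Z ⇒ Y} → π₂ ∘ ⟨ f , g ⟩ ≈ g
    ⟨⟩-unique : ∀ {Z X Y} {f : Z ⇒ X} {g : Z ⇒ Y} {h : Z ⇒ X × Y} →
                π₁ ∘ h ≈ f → π₂ ∘ h ≈ g → h ≈ ⟨ f , g ⟩
    _^_      : Obj → Obj → Obj
    ev       : ∀ {B A} → B ^ A × A ⇒ B
    _†       : ∀ {Z A B} → Z × A ⇒ B → Z ⇒ B ^ A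
    β        : ∀ {Z A B} {f : Z × A ⇒ B} →
               ev ∘ ⟨ (f †) ∘ π₁ , id ∘ π₂ ⟩ ≈ f
    †-unique : ∀ {Z A B} {f : Z × A ⇒ B} {g : Z ⇒ B ^ A} →
               ev ∘ ⟨ g ∘ π₁ , id ∘ π₂ ⟩ ≈ f → g ≈ f †
    Pb        : ∀ {X Y Z} → X ⇒ Z → Y ⇒ Z → Obj
    pb₁       : ∀ {X Y Z} {f : X ⇒ Z} {g : Y ⇒ Z} → Pb f g ⇒ X
    pb₂       : ∀ {X Y Z} {f : X ⇒ Z} {g : Y ⇒ Z} → Pb f g ⇒ Y
    pb-comm   : ∀ {X Y Z} {f : X ⇒ Z} {g : Y ⇒ Z} → f ∘ pb₁ {f = f} {g} ≈ g ∘ pb₂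
    pb-univ   : ∀ {X Y Z W} {f : X ⇒ Z} {g : Y ⇒ Z} (a : W ⇒ X) (b : W ⇒ Y) →
                f ∘ a ≈ g ∘ b → W ⇒ Pb f g
    pb-univ₁  : ∀ {X Y Z W} {f : X ⇒ Z} {g : Y ⇒ Z} {a : W ⇒ X} {b : W ⇒ Y}
                (eq : f ∘ a ≈ g ∘ b) → pb₁ ∘ pb-univ a b eq ≈ a
    pb-univ₂  : ∀ {X Y Z W} {f : X ⇒ Z} {g : Y ⇒ Z} {a : W ⇒ X} {b : W ⇒ Y}
                (eq : f ∘ a ≈ g ∘ b) → pb₂ ∘ pb-univ a b eq ≈ b
    pb-unique : ∀ {X Y Z W} {f : X ⇒ Z} {g : Y ⇒ Z} {a : W ⇒ X} {b : W ⇒ Y}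
                (eq : f ∘ a ≈ g ∘ b) (k : W ⇒ Pb f g) →
                pb₁ ∘ k ≈ a → pb₂ ∘ k ≈ b → k ≈ pb-univ a b eq
    ∐         : (ℕ → Obj) → Obj
    ι         : ∀ {X : ℕ → Obj} (n : ℕ) → X n ⇒ ∐ X
    [_]       : ∀ {X : ℕ → Obj} {Y} → ((n : ℕ) → X n ⇒ Y) → ∐ X ⇒ Y
    inject    : ∀ {X : ℕ → Obj} {Y} {f : (n : ℕ) → X n ⇒ Y} (n : ℕ) →
                [ f ] ∘ ι n ≈ f n
    []-unique : ∀ {X : ℕ → Obj} {Y} {f : (n : ℕ) → X n ⇒ Y} {g : ∐ X ⇒ Y} →
                ((n : ℕ) → g ∘ ι n ≈ f n) → g ≈ [ f ]

module CCCOps {o ℓ e} {C : Category o ℓ e} (K : CCCStructure C) where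
  open Category C
  open CCCStructure K

  infixr 8 _⁂_
  _⁂_ : ∀ {X Y X′ Y′} → X ⇒ X′ → Y ⇒ Y′ → X × Y ⇒ X′ × Y′
  f ⁂ g = ⟨ f ∘ π₁ , g ∘ π₂ ⟩

  α⇒ : ∀ {X Y Z} → (X × Y) × Z ⇒ X × (Y × Z)
  α⇒ = ⟨ π₁ ∘ π₁ , ⟨ π₂ ∘ π₁ , π₂ ⟩ ⟩

  _^₁_ : ∀ {X Y} → X ⇒ Y → (A : Obj) → X ^ A ⇒ Y ^ A
  f ^₁ A = (f ∘ ev) †

record Endofunctor {o ℓ e} (C : Category o ℓ e) : Set (o ⊔ ℓ ⊔ e) where
  open Category C
  field
    F₀           : Obj → Obj
    F₁           : ∀ {X Y} → X ⇒ Y → F₀ X ⇒ F₀ Y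
    F-resp-≈     : ∀ {X Y} {f g : X ⇒ Y} → f ≈ g → F₁ f ≈ F₁ g
    identity     : ∀ {X} → F₁ (id {X}) ≈ id
    homomorphism : ∀ {X Y Z} {f : X ⇒ Y} {g : Y ⇒ Z} → F₁ (g ∘ f) ≈ F₁ g ∘ F₁ f

record StrongEndofunctor {o ℓ e} {C : Category o ℓ e} (K : CCCStructure C)
       : Set (o ⊔ ℓ ⊔ e) where
  open Category C
  open CCCStructure K
  open CCCOps K
  field
    functor : Endofunctor C
  open Endofunctor functor
  field
    st        : ∀ {X Y} → X × F₀ Y ⇒ F₀ (X × Y)
    st-nat    : ∀ {X Y X′ Y′} {f : X ⇒ X′} {g : Y ⇒ Y′} →
                st ∘ (f ⁂ F₁ g) ≈ F₁ (f ⁂ g) ∘ st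
    st-unit   : ∀ {Y} → F₁ π₂ ∘ st {⊤} {Y} ≈ π₂
    st-assoc  : ∀ {X Y Z} →
                st ∘ (id ⁂ st) ∘ α⇒ {X} {Y} {F₀ Z} ≈ F₁ α⇒ ∘ st

record StrongMonad {o ℓ e} {C : Category o ℓ e} (K : CCCStructure C)
       : Set (o ⊔ ℓ ⊔ e) where
  open Category C
  open CCCStructure K
  open CCCOps K
  field
    strongFunctor : StrongEndofunctor K
  open StrongEndofunctor strongFunctor
  open Endofunctor functor
  field
    η         : ∀ {X} → X ⇒ F₀ X
    μ         : ∀ {X} → F₀ (F₀ X) ⇒ F₀ X
    η-nat     : ∀ {X Y} {f : X ⇒ Y} → η ∘ f ≈ F₁ f ∘ η
    μ-nat     : ∀ {X Y} {f : X ⇒ Y} → μ ∘ F₁ (F₁ f) ≈ F₁ f ∘ μ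
    μ-assoc   : ∀ {X} → μ ∘ F₁ (μ {X}) ≈ μ ∘ μ
    μ-unitˡ   : ∀ {X} → μ ∘ F₁ (η {X}) ≈ id
    μ-unitʳ   : ∀ {X} → μ ∘ η {F₀ X} ≈ id
    st-η      : ∀ {X Y} → st ∘ (id ⁂ η) ≈ η {X × Y}
    st-μ      : ∀ {X Y} → st ∘ (id ⁂ μ) ≈ μ ∘ F₁ st ∘ st {X} {F₀ Y}

record OrderedObject {o ℓ e} (C : Category o ℓ e) (ℓ≤ : Level)
       : Set (o ⊔ lsuc ℓ ⊔ e ⊔ lsuc ℓ≤) where
  open Category C
  infix 4 _≤_
  field
    Ω          : Obj
    _≤_        : ∀ {X} → Rel (X ⇒ Ω) ℓ≤
    isPO       : ∀ {X} → IsPartialOrder (_≈_ {X} {Ω}) _≤_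
    ⋁          : ∀ {X} {J : Set ℓ} → (J → X ⇒ Ω) → X ⇒ Ω
    ⋁-ub       : ∀ {X} {J : Set ℓ} (f : J → X ⇒ Ω) (j : J) → f j ≤ ⋁ f
    ⋁-least    : ∀ {X} {J : Set ℓ} (f : J → X ⇒ Ω) (g : X ⇒ Ω) →
                 ((j : J) → f j ≤ g) → ⋁ f ≤ g
    ⋁-precomp  : ∀ {X Y} {J : Set ℓ} (f : J → Y ⇒ Ω) (k : X ⇒ Y) →
                 ⋁ f ∘ k ≈ ⋁ (λ j → f j ∘ k)

  ⊥Ω : ∀ {X} → X ⇒ Ω
  ⊥Ω = ⋁ {J = Lift ℓ ⊥} (λ ())

record Setting (o ℓ e ℓ≤ : Level) : Set (lsuc (o ⊔ ℓ ⊔ e ⊔ ℓ≤)) where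
  field
    C   : Category o ℓ e
    K   : CCCStructure C
    T   : StrongMonad K
    F   : StrongEndofunctor K
    OO  : OrderedObject C ℓ≤
  open Category C
  open OrderedObject OO
  module T = StrongMonad T
  module TS = StrongEndofunctor T.strongFunctor
  module TF = Endofunctor TS.functor
  module F = StrongEndofunctor F
  module FF = Endofunctor F.functor
  field
    τ      : FF.F₀ (TF.F₀ Ω) ⇒ Ω
    τ-mono : ∀ {X} {g h : X ⇒ Ω} → g ≤ h →
             τ ∘ FF.F₁ (TF.F₁ g) ≤ τ ∘ FF.F₁ (TF.F₁ h)
    A   : Obj
    I   : Obj

module SettingOps {o ℓ e ℓ≤} (𝒮 : Setting o ℓ e ℓ≤) where
  open Setting 𝒮 public
  open Category C public
  open CCCStructure K public
  open CCCOps K public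
  open OrderedObject OO public

  FT₀ : Obj → Obj
  FT₀ X = FF.F₀ (TF.F₀ X)

  FT₁ : ∀ {X Y} → X ⇒ Y → FT₀ X ⇒ FT₀ Y
  FT₁ f = FF.F₁ (TF.F₁ f)

  stFT : ∀ {X Y} → X × FT₀ Y ⇒ FT₀ (X × Y)
  stFT = FF.F₁ TS.st ∘ F.st

  Φ : ∀ {X} → X ⇒ FT₀ X → X ⇒ Ω → X ⇒ Ω
  Φ e g = τ ∘ FT₁ g ∘ e

  Φ^ : ∀ {X} → X ⇒ FT₀ X → ℕ → X ⇒ Ω → X ⇒ Ω
  Φ^ e zero    g = g
  Φ^ e (suc n) g = Φ e (Φ^ e n g)

  -- sequences: X^0 = ⊤, X^(n+1) = X^n × X;  X⁺ = ∐_{n≥1} X^n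
  pow : Obj → ℕ → Obj
  pow X zero    = ⊤
  pow X (suc n) = pow X n × X

  pow₁ : ∀ {X Y} → X ⇒ Y → (n : ℕ) → pow X n ⇒ pow Y n
  pow₁ f zero    = id
  pow₁ f (suc n) = pow₁ f n ⁂ f

  infixl 30 _⁺ _⁺₁
  _⁺ : Obj → Obj
  X ⁺ = ∐ (λ n → pow X (suc n))

  _⁺₁ : ∀ {X Y} → X ⇒ Y → X ⁺ ⇒ Y ⁺
  f ⁺₁ = [ (λ n → ι n ∘ pow₁ f (suc n)) ]

  -- length-one sequences
  nil : ∀ {X} → X ⇒ X ⁺
  nil = ι 0 ∘ ⟨ ! , id ⟩

  last : ∀ {X} → X ⁺ ⇒ X
  last = [ (λ n → π₂) ]

  -- appending an element: ext : S⁺ × S → S⁺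
  ext : ∀ {X} → X ⁺ × X ⇒ X ⁺
  ext {X} = ev ∘ ([ (λ n → ι {X = λ k → pow X (suc k)} (suc n) †) ] ⁂ id)

  -- π₁ Hist(c) for c = ⟨ δ , p ⟩
  hist : ∀ {S} → S ⇒ FT₀ S ^ A → S ⁺ ⇒ FT₀ (S ⁺) ^ A
  hist δ = (FT₁ ext ^₁ A) ∘ ((stFT ∘ (id ⁂ ev) ∘ α⇒) †) ∘ ⟨ id , δ ∘ last ⟩

  Hist : ∀ {S P} → S ⇒ FT₀ S ^ A → S ⇒ P → S ⁺ ⇒ FT₀ (S ⁺) ^ A × P ⁺
  Hist δ p = ⟨ hist δ , p ⁺₁ ⟩

  Histᵤ : ∀ {S P} → S ⇒ FT₀ S ^ A → S ⇒ P → P ⁺ ⇒ A → S ⁺ ⇒ FT₀ (S ⁺)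
  Histᵤ δ p u = ev ∘ ⟨ hist δ , u ∘ p ⁺₁ ⟩

  H : ∀ {S P} → I ⇒ S → S ⇒ FT₀ S ^ A → S ⇒ P → I ⇒ Ω
  H {S} {P} i δ p =
    ⋁ {J = (P ⁺ ⇒ A) ×ₚ ℕ}
      (λ { (u , n) → Φ^ (Histᵤ δ p u) n ⊥Ω ∘ nil ∘ i })

module Submission where

-- Along the subcoalgebra m, each term Φⁿ_{Hist(c)_u}(⊥) ∘ nil ∘ i of H(i, ⟨δ, p⟩) equals
-- the corresponding iterate for the coalgebra ev ∘ ⟨δ′, v⟩ on S′ started at i′, where the
-- policy seen on S′ is v = u ∘ p⁺ ∘ m.  So H(i, ⟨δ, p⟩) only depends on which policies
-- S′ ⇒ A factor through p⁺ ∘ m.  Every one factoring through obs⁺ ∘ m factors through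
-- m, and conversely u ∘ m = (u ∘ m ∘ r) ∘ obs⁺ ∘ m for a retraction r of obs⁺ ∘ m.

open import Data.Nat using (ℕ; zero; suc)
open import Data.Product using (Σ; _,_; proj₁; proj₂)
open import Relation.Binary using (Setoid; IsEquivalence; IsPartialOrder)
import Relation.Binary.Reasoning.Setoid as SetoidReasoning

open import Defs

module HomReasoning {o ℓ e} (C : Category o ℓ e) where
  open Category C

  hom-setoid : (X Y : Obj) → Setoid ℓ e
  hom-setoid X Y = record { Carrier = X ⇒ Y ; _≈_ = _≈_ ; isEquivalence = equiv }

  module _ {X Y : Obj} where
    open IsEquivalence (equiv {X} {Y}) public
      using () renaming (refl to ≈-refl; sym to ≈-sym; trans to ≈-trans)
    open SetoidReasoning (hom-setoid X Y) public

  ∘-resp-≈ˡ : ∀ {X Y Z} {f f′ : Y ⇒ Z} {g : X ⇒ Y} → f ≈ f′ → f ∘ g ≈ f′ ∘ g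
  ∘-resp-≈ˡ p = ∘-resp-≈ p ≈-refl

  ∘-resp-≈ʳ : ∀ {X Y Z} {f : Y ⇒ Z} {g g′ : X ⇒ Y} → g ≈ g′ → f ∘ g ≈ f ∘ g′
  ∘-resp-≈ʳ p = ∘-resp-≈ ≈-refl p

module CartesianClosedLemmas {o ℓ e} {C : Category o ℓ e} (K : CCCStructure C) where
  open Category C
  open CCCStructure K
  open CCCOps K
  open HomReasoning C

  ⟨⟩-cong : ∀ {Z X Y} {f f′ : Z ⇒ X} {g g′ : Z ⇒ Y} →
            f ≈ f′ → g ≈ g′ → ⟨ f , g ⟩ ≈ ⟨ f′ , g′ ⟩
  ⟨⟩-cong p q = ⟨⟩-unique (≈-trans project₁ p) (≈-trans project₂ q)

  ⟨⟩∘ : ∀ {W Z X Y} {f : Z ⇒ X} {g : Z ⇒ Y} {h : W ⇒ Z} →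
        ⟨ f , g ⟩ ∘ h ≈ ⟨ f ∘ h , g ∘ h ⟩
  ⟨⟩∘ = ⟨⟩-unique (≈-trans (≈-sym assoc) (∘-resp-≈ˡ project₁))
                  (≈-trans (≈-sym assoc) (∘-resp-≈ˡ project₂))

  ⁂∘⟨⟩ : ∀ {W X Y X′ Y′} {f : X ⇒ X′} {g : Y ⇒ Y′} {a : W ⇒ X} {b : W ⇒ Y} →
         (f ⁂ g) ∘ ⟨ a , b ⟩ ≈ ⟨ f ∘ a , g ∘ b ⟩
  ⁂∘⟨⟩ = ≈-trans ⟨⟩∘ (⟨⟩-cong (≈-trans assoc (∘-resp-≈ʳ project₁))
                                (≈-trans assoc (∘-resp-≈ʳ project₂)))

  ev∘⟨^₁⟩ : ∀ {W X Y B} {f : X ⇒ Y} {g : W ⇒ X ^ B} {b : W ⇒ B} →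
            ev ∘ ⟨ (f ^₁ B) ∘ g , b ⟩ ≈ f ∘ ev ∘ ⟨ g , b ⟩
  ev∘⟨^₁⟩ {f = f} {g} {b} = begin
    ev ∘ ⟨ (f ^₁ _) ∘ g , b ⟩                ≈⟨ ∘-resp-≈ʳ (⟨⟩-cong ≈-refl (≈-sym identityˡ)) ⟩
    ev ∘ ⟨ (f ^₁ _) ∘ g , id ∘ b ⟩           ≈⟨ ∘-resp-≈ʳ (≈-sym ⁂∘⟨⟩) ⟩
    ev ∘ ((f ^₁ _) ⁂ id) ∘ ⟨ g , b ⟩         ≈⟨ ≈-sym assoc ⟩
    (ev ∘ ((f ^₁ _) ⁂ id)) ∘ ⟨ g , b ⟩       ≈⟨ ∘-resp-≈ˡ β ⟩
    (f ∘ ev) ∘ ⟨ g , b ⟩                     ≈⟨ assoc ⟩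
    f ∘ ev ∘ ⟨ g , b ⟩                       ∎

module JoinLemmas {o ℓ e ℓ≤} {C : Category o ℓ e} (OO : OrderedObject C ℓ≤) where
  open Category C
  open OrderedObject OO
  private module PO {X} = IsPartialOrder (isPO {X})

  ⋁-≤-⋁ : ∀ {X} {J₁ J₂ : Set ℓ} (f₁ : J₁ → X ⇒ Ω) (f₂ : J₂ → X ⇒ Ω) →
          ((j : J₁) → Σ J₂ (λ j′ → f₁ j ≈ f₂ j′)) → ⋁ f₁ ≤ ⋁ f₂
  ⋁-≤-⋁ f₁ f₂ match = ⋁-least f₁ (⋁ f₂) λ j →
    PO.trans (PO.reflexive (proj₂ (match j))) (⋁-ub f₂ (proj₁ (match j)))

module SettingLemmas {o ℓ e ℓ≤} (𝒮 : Setting o ℓ e ℓ≤) where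
  open SettingOps 𝒮
  open HomReasoning C
  open CartesianClosedLemmas K

  pow₁-id : ∀ {X} n → pow₁ (id {X}) n ≈ id
  pow₁-id zero    = ≈-refl
  pow₁-id (suc n) = begin
    pow₁ id n ⁂ id       ≈⟨ ⟨⟩-cong (∘-resp-≈ˡ (pow₁-id n)) ≈-refl ⟩
    ⟨ id ∘ π₁ , id ∘ π₂ ⟩ ≈⟨ ≈-sym (⟨⟩-unique (≈-trans identityʳ (≈-sym identityˡ))
                                               (≈-trans identityʳ (≈-sym identityˡ))) ⟩
    id                    ∎

  ⁺₁-id : ∀ {X} → id {X} ⁺₁ ≈ id
  ⁺₁-id = ≈-sym ([]-unique λ n →
    ≈-trans identityˡ (≈-sym (≈-trans (∘-resp-≈ʳ (pow₁-id (suc n))) identityʳ)))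

  ∘-id⁺₁-∘ : ∀ {X Y Z} (f : X ⇒ Z ⁺) {u : Z ⁺ ⇒ Y} → u ∘ id ⁺₁ ∘ f ≈ u ∘ f
  ∘-id⁺₁-∘ f = ∘-resp-≈ʳ (≈-trans (∘-resp-≈ˡ ⁺₁-id) identityˡ)

  FT₁-∘ : ∀ {X Y Z} {f : X ⇒ Y} {g : Y ⇒ Z} → FT₁ (g ∘ f) ≈ FT₁ g ∘ FT₁ f
  FT₁-∘ = ≈-trans (FF.F-resp-≈ TF.homomorphism) FF.homomorphism

  Φ^-resp-≈ : ∀ {X} {e₁ e₂ : X ⇒ FT₀ X} {g₁ g₂ : X ⇒ Ω} n →
              e₁ ≈ e₂ → g₁ ≈ g₂ → Φ^ e₁ n g₁ ≈ Φ^ e₂ n g₂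
  Φ^-resp-≈ zero    p q = q
  Φ^-resp-≈ (suc n) p q =
    ∘-resp-≈ʳ (∘-resp-≈ (FF.F-resp-≈ (TF.F-resp-≈ (Φ^-resp-≈ n p q))) p)

  Φ^-∘-coalgebra-hom : ∀ {X Y} {e : Y ⇒ FT₀ Y} {e′ : X ⇒ FT₀ X} {h : X ⇒ Y}
                       (g : Y ⇒ Ω) n → e ∘ h ≈ FT₁ h ∘ e′ →
                       Φ^ e n g ∘ h ≈ Φ^ e′ n (g ∘ h)
  Φ^-∘-coalgebra-hom g zero    hom = ≈-refl
  Φ^-∘-coalgebra-hom {e = e} {e′} {h} g (suc n) hom = begin
    (τ ∘ FT₁ (Φ^ e n g) ∘ e) ∘ h         ≈⟨ ≈-trans assoc (∘-resp-≈ʳ assoc) ⟩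
    τ ∘ FT₁ (Φ^ e n g) ∘ e ∘ h           ≈⟨ ∘-resp-≈ʳ (∘-resp-≈ʳ hom) ⟩
    τ ∘ FT₁ (Φ^ e n g) ∘ FT₁ h ∘ e′      ≈⟨ ∘-resp-≈ʳ (≈-sym assoc) ⟩
    τ ∘ (FT₁ (Φ^ e n g) ∘ FT₁ h) ∘ e′    ≈⟨ ∘-resp-≈ʳ (∘-resp-≈ˡ (≈-sym FT₁-∘)) ⟩
    τ ∘ FT₁ (Φ^ e n g ∘ h) ∘ e′          ≈⟨ ∘-resp-≈ʳ (∘-resp-≈ˡ
                                              (FF.F-resp-≈ (TF.F-resp-≈ (Φ^-∘-coalgebra-hom g n hom)))) ⟩
    τ ∘ FT₁ (Φ^ e′ n (g ∘ h)) ∘ e′       ∎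

module SubcoalgebraLemmas {o ℓ e ℓ≤} (𝒮 : Setting o ℓ e ℓ≤) where
  open SettingOps 𝒮
  open HomReasoning C
  open CartesianClosedLemmas K
  open JoinLemmas OO
  open SettingLemmas 𝒮

  module Subcoalgebra {S S′ : Obj} (i : I ⇒ S) (δ : S ⇒ FT₀ S ^ A)
           (m : S′ ⇒ S ⁺) (δ′ : S′ ⇒ FT₀ S′ ^ A) (i′ : I ⇒ S′)
           (m∘i′≈nil∘i : m ∘ i′ ≈ nil ∘ i)
           (hist∘m≈δ′ : hist δ ∘ m ≈ (FT₁ m ^₁ A) ∘ δ′) where

    δ′-at : S′ ⇒ A → S′ ⇒ FT₀ S′
    δ′-at v = ev ∘ ⟨ δ′ , v ⟩

    restricted-term : S′ ⇒ A → ℕ → I ⇒ Ω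
    restricted-term v n = Φ^ (δ′-at v) n (⊥Ω ∘ m) ∘ i′

    restricted-term-cong : ∀ {v v′} n → v ≈ v′ → restricted-term v n ≈ restricted-term v′ n
    restricted-term-cong n v≈v′ =
      ∘-resp-≈ˡ (Φ^-resp-≈ n (∘-resp-≈ʳ (⟨⟩-cong ≈-refl v≈v′)) ≈-refl)

    Histᵤ-∘-m : ∀ {P} (p : S ⇒ P) (u : P ⁺ ⇒ A) →
                Histᵤ δ p u ∘ m ≈ FT₁ m ∘ δ′-at (u ∘ p ⁺₁ ∘ m)
    Histᵤ-∘-m p u = begin
      (ev ∘ ⟨ hist δ , u ∘ p ⁺₁ ⟩) ∘ m            ≈⟨ assoc ⟩
      ev ∘ ⟨ hist δ , u ∘ p ⁺₁ ⟩ ∘ m              ≈⟨ ∘-resp-≈ʳ ⟨⟩∘ ⟩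
      ev ∘ ⟨ hist δ ∘ m , (u ∘ p ⁺₁) ∘ m ⟩        ≈⟨ ∘-resp-≈ʳ (⟨⟩-cong hist∘m≈δ′ assoc) ⟩
      ev ∘ ⟨ (FT₁ m ^₁ A) ∘ δ′ , u ∘ p ⁺₁ ∘ m ⟩   ≈⟨ ev∘⟨^₁⟩ ⟩
      FT₁ m ∘ δ′-at (u ∘ p ⁺₁ ∘ m)                ∎

    H-term≈restricted-term : ∀ {P} (p : S ⇒ P) (u : P ⁺ ⇒ A) n →
      Φ^ (Histᵤ δ p u) n ⊥Ω ∘ nil ∘ i ≈ restricted-term (u ∘ p ⁺₁ ∘ m) n
    H-term≈restricted-term p u n = begin
      Φ^ (Histᵤ δ p u) n ⊥Ω ∘ nil ∘ i        ≈⟨ ∘-resp-≈ʳ (≈-sym m∘i′≈nil∘i) ⟩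
      Φ^ (Histᵤ δ p u) n ⊥Ω ∘ m ∘ i′         ≈⟨ ≈-sym assoc ⟩
      (Φ^ (Histᵤ δ p u) n ⊥Ω ∘ m) ∘ i′       ≈⟨ ∘-resp-≈ˡ (Φ^-∘-coalgebra-hom ⊥Ω n (Histᵤ-∘-m p u)) ⟩
      restricted-term (u ∘ p ⁺₁ ∘ m) n       ∎

    H-≤-if-policies-factor : ∀ {P Q} (p : S ⇒ P) (q : S ⇒ Q) →
      ((u : P ⁺ ⇒ A) → Σ (Q ⁺ ⇒ A) λ u′ → u ∘ p ⁺₁ ∘ m ≈ u′ ∘ q ⁺₁ ∘ m) →
      H i δ p ≤ H i δ q
    H-≤-if-policies-factor p q factor = ⋁-≤-⋁ _ _ λ { (u , n) →
      let (u′ , u≈u′) = factor u in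
      (u′ , n) , (begin
        Φ^ (Histᵤ δ p u) n ⊥Ω ∘ nil ∘ i      ≈⟨ H-term≈restricted-term p u n ⟩
        restricted-term (u ∘ p ⁺₁ ∘ m) n     ≈⟨ restricted-term-cong n u≈u′ ⟩
        restricted-term (u′ ∘ q ⁺₁ ∘ m) n    ≈⟨ ≈-sym (H-term≈restricted-term q u′ n) ⟩
        Φ^ (Histᵤ δ q u′) n ⊥Ω ∘ nil ∘ i     ∎) }

proposition7p3 : ∀ {o ℓ e ℓ≤} (𝒮 : Setting o ℓ e ℓ≤) →
    let open SettingOps 𝒮 in
    ∀ {S O S′ : Obj}
    (i : I ⇒ S) (δ : S ⇒ FT₀ S ^ A) (obs : S ⇒ O)
    (m : S′ ⇒ S ⁺) (δ′ : S′ ⇒ FT₀ S′ ^ A) (i′ : I ⇒ S′) →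
    Mono C m →
    m ∘ i′ ≈ nil ∘ i →
    π₁ ∘ Hist δ obs ∘ m ≈ (FT₁ m ^₁ A) ∘ δ′ →
    SplitMono C (obs ⁺₁ ∘ m) →
    H i δ obs ≈ H i δ id
proposition7p3 𝒮 {S} i δ obs m δ′ i′ _ m∘i′≈nil∘i π₁∘Hist∘m≈δ′ (r , r∘obs⁺∘m≈id) =
  IsPartialOrder.antisym isPO
    (H-≤-if-policies-factor obs id λ u → u ∘ obs ⁺₁ , ≈-sym (≈-trans (∘-id⁺₁-∘ m) assoc))
    (H-≤-if-policies-factor id obs λ u → u ∘ m ∘ r , u∘m-factors-through-obs u)
  where
  open SettingOps 𝒮
  open HomReasoning C
  open SettingLemmas 𝒮
  open SubcoalgebraLemmas 𝒮
  open Subcoalgebra i δ m δ′ i′ m∘i′≈nil∘i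
         (≈-trans (∘-resp-≈ˡ (≈-sym project₁)) (≈-trans assoc π₁∘Hist∘m≈δ′))

  u∘m-factors-through-obs : (u : S ⁺ ⇒ A) → u ∘ id ⁺₁ ∘ m ≈ (u ∘ m ∘ r) ∘ obs ⁺₁ ∘ m
  u∘m-factors-through-obs u = begin
    u ∘ id ⁺₁ ∘ m             ≈⟨ ∘-id⁺₁-∘ m ⟩
    u ∘ m                     ≈⟨ ∘-resp-≈ʳ (≈-sym (≈-trans (∘-resp-≈ʳ r∘obs⁺∘m≈id) identityʳ)) ⟩
    u ∘ m ∘ r ∘ obs ⁺₁ ∘ m    ≈⟨ ≈-sym (≈-trans assoc (∘-resp-≈ʳ assoc)) ⟩
    (u ∘ m ∘ r) ∘ obs ⁺₁ ∘ m  ∎
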